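{- Let $w \geq 1$ and let $p, q, r, s, x \in \mathbb{Z}/2^w\mathbb{Z}$ be arbitrary (in particular $x$ may occur inside $p,q,r,s$ when these are polynomial terms, but the implications are claimed for all values). Then all of the following implications hold: \begin{enumerate} \item $p x <_u q x \implies p \neq q$; \item $p x <_u q x \implies \Omega(p,x) \lor p <_u q$; \item $p x <_u q x \implies \Omega(-q,x) \lor p <_u q$; \item $p x <_u q x \implies \Omega(q,-x) \lor p >_u q \lor p = 0$; \item $p x <_u q x \implies \Omega(-p,-x) \lor p >_u q \lor p = 0$; \item $p x \leq_u q x \implies \Omega(p,x) \lor p \leq_u q \lor x = 0$; \item $p x \leq_u q x \implies \Omega(-q,x) \lor p \leq_u q \lor x = 0 \lor q = 0$; \item $p x \leq_u q x \implies \Omega(q,-x) \lor p \geq_u q \lor x = 0 \lor p = 0$; \item $p x \leq_u q x \implies \Omega(-p,-x) \lor p \geq_u q \lor x = 0 \lor p = 0$; \item $p x + s \leq_u q \implies \Omega(p,x) \lor \Omega_{+}(px,s) \lor p r \leq_u q \lor x <_u r$; \item $p \leq_u x \land q x \leq_u r \implies \Omega(q,x) \lor pq \leq_u r$; \item $p \leq_u x \land q x <_u r \implies \Omega(q,x) \lor pq <_u r$; \item $p <_u x \land q x \leq_u r \implies \Omega(q,x) \lor pq <_u r \lor q = 0$; \item $p <_u x \land q x \leq_u r \implies \Omega(q,x) \lor pq <_u r \lor r = 0$; \item $p \leq_u q x \land x \leq_u r \implies \Omega(q,r) \lor p \leq_u qr$; \item $p <_u q x \land x \leq_u r \implies \Omega(q,r)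 \lor p <_u qr$; \item $p \leq_u q x \land x <_u r \implies \Omega(q,r) \lor p <_u qr \lor p = 0$; \item $p \leq_u q x \land x <_u r \implies \Omega(q,r) \lor p <_u qr \lor q = 0$. \end{enumerate}
   Context: Bit-vectors of width $w$ are elements of the ring $\mathbb{Z}/2^w\mathbb{Z}$; all arithmetic ($+$, $-$, multiplication) is modulo $2^w$, and $-a$ denotes the additive inverse modulo $2^w$. Each element is identified with its unsigned representative in $\{0,1,\dots,2^w-1\}$. $a \leq_u b$ (resp. $a <_u b$, $\geq_u$, $>_u$) means the corresponding comparison of the unsigned representatives. The multiplication-overflow predicate $\Omega(a,b)$ holds iff the integer product of the unsigned representatives of $a$ and $b$ is at least $2^w$. The addition-overflow predicate $\Omega_{+}(a,b)$ holds iff the integer sum of the unsigned representatives of $a$ and $b$ is at least $2^w$. -}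

module Defs where

open import Data.Nat using (ℕ; _+_; _*_; _∸_; _^_; _≤_; _<_; _≥_; NonZero)
open import Data.Nat.Properties using (m^n≢0)
open import Data.Nat.DivMod using (_mod_)
open import Data.Fin using (Fin; toℕ)
open import Relation.Binary.PropositionalEquality using (_≡_)

-- Bit-vectors of width w: elements of ℤ/2^w ℤ, represented by their unsigned
-- representative as an element of Fin (2 ^ w).
-- (wrapped in a record so that the width w is inferable)
record BV (w : ℕ) : Set where
  constructor bv
  field
    val : Fin (2 ^ w)

open BV public

u : ∀ {w} → BV w → ℕ
u a = toℕ (val a)

M : ℕ → ℕ
M w = 2 ^ w

red : (w : ℕ) → ℕ → BV w
red w n = bv (_mod_ n (2 ^ w) {{m^n≢0 2 w}})

_⊕_ : ∀ {w} → BV w → BV w → BV w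
_⊕_ {w} a b = red w (u a + u b)

_⊗_ : ∀ {w} → BV w → BV w → BV w
_⊗_ {w} a b = red w (u a * u b)

⊖_ : ∀ {w} → BV w → BV w
⊖_ {w} a = red w (2 ^ w ∸ u a)

infixl 6 _⊕_
infixl 7 _⊗_
infix 8 ⊖_

𝟘 : ∀ {w} → BV w
𝟘 {w} = red w 0

_≤u_ : ∀ {w} → BV w → BV w → Set
a ≤u b = u a ≤ u b

_<u_ : ∀ {w} → BV w → BV w → Set
a <u b = u a < u b

_≥u_ : ∀ {w} → BV w → BV w → Set
a ≥u b = b ≤u a

_>u_ : ∀ {w} → BV w → BV w → Set
a >u b = b <u a

infix 4 _≤u_ _<u_ _≥u_ _>u_

Ω : ∀ {w} → BV w → BV w → Set
Ω {w} a b = u a * u b ≥ 2 ^ w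

Ω₊ : ∀ {w} → BV w → BV w → Set
Ω₊ {w} a b = u a + u b ≥ 2 ^ w

{-# OPTIONS --safe #-}
-- Write ā = 2^w ∸ a for the representative of ⊖ a when a ≠ 0. Reducing the identities
-- a·x + ā·x = 2^w·x and a·x + 2^w·2^w = ā·x̄ + (a + x)·2^w modulo 2^w shows that u (a ⊗ x)
-- equals a·x, 2^w ∸ ā·x, 2^w ∸ a·x̄ or ā·x̄ as soon as the corresponding product is below 2^w.
-- Such a bound persists on an interval of values of a, on which a ↦ a ⊗ x is therefore
-- monotone or antitone. Each implication is the contrapositive of one of these monotonicity
-- facts, or a transitivity through a product that does not overflow.
module Submission where

open import Defs
open import Data.Nat using (ℕ; _≤_)
open import Data.Product using (_×_)
open import Data.Sum using (_⊎_)
open import Relation.Binary.PropositionalEquality using (_≡_; _≢_)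

open import Data.Nat using (_<_; _+_; _*_; _∸_; _^_; _≤?_; _<?_; zero; suc; z<s; NonZero; >-nonZero; >-nonZero⁻¹)
open import Data.Nat.Properties
open import Data.Nat.DivMod using (_%_; %-congˡ; [m+kn]%n≡m%n; m<n⇒m%n≡m; m%n≤m)
open import Data.Nat.Tactic.RingSolver using (solve)
open import Data.List using (_∷_; [])
open import Data.Fin.Properties using (toℕ<n; toℕ-fromℕ<; toℕ-injective)
open import Data.Product using (_,_)
open import Data.Sum using (inj₁; inj₂)
open import Relation.Nullary using (¬_; Dec; yes; no; contradiction)
open import Relation.Binary.PropositionalEquality using (refl; sym; trans; cong; cong₂; subst; subst₂; module ≡-Reasoning)

m+jn≡r+kn⇒m%n≡r : ∀ {m r} j k {n} .{{_ : NonZero n}} → m + j * n ≡ r + k * n → r < n → m % n ≡ r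
m+jn≡r+kn⇒m%n≡r {m} {r} j k {n} eq r<n = begin
  m % n             ≡⟨ [m+kn]%n≡m%n m j n ⟨
  (m + j * n) % n   ≡⟨ %-congˡ eq ⟩
  (r + k * n) % n   ≡⟨ [m+kn]%n≡m%n r k n ⟩
  r % n             ≡⟨ m<n⇒m%n≡m r<n ⟩
  r                 ∎
  where open ≡-Reasoning

m+k≡n⇒[m*o]%n≡n∸k*o : ∀ m k o {n} .{{_ : NonZero n}} → m + k ≡ n → 0 < k * o → k * o < n →
                      (m * o) % n ≡ n ∸ k * o
m+k≡n⇒[m*o]%n≡n∸k*o m k o {n} m+k≡n 0<ko ko<n =
  m+jn≡r+kn⇒m%n≡r 1 o (+-cancelˡ-≡ (k * o) _ _ (begin
    k * o + (m * o + 1 * n)       ≡⟨ solve (m ∷ k ∷ n ∷ o ∷ []) ⟩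
    (m + k) * o + n               ≡⟨ cong (λ t → t * o + n) m+k≡n ⟩
    n * o + n                     ≡⟨ solve (n ∷ o ∷ []) ⟩
    n + o * n                     ≡⟨ cong (_+ o * n) (m+[n∸m]≡n (<⇒≤ ko<n)) ⟨
    k * o + (n ∸ k * o) + o * n   ≡⟨ +-assoc (k * o) (n ∸ k * o) (o * n) ⟩
    k * o + (n ∸ k * o + o * n)   ∎))
    (∸-monoʳ-< 0<ko (<⇒≤ ko<n))
  where open ≡-Reasoning

m+k≡n⇒o+l≡n⇒[m*o]%n≡k*l : ∀ m k o l {n} .{{_ : NonZero n}} → m + k ≡ n → o + l ≡ n → k * l < n →
                          (m * o) % n ≡ k * l
m+k≡n⇒o+l≡n⇒[m*o]%n≡k*l m k o l {n} m+k≡n o+l≡n kl<n =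
  m+jn≡r+kn⇒m%n≡r n (m + o) (begin
    m * o + n * n                        ≡⟨ cong (m * o +_) (cong₂ _*_ m+k≡n o+l≡n) ⟨
    m * o + (m + k) * (o + l)            ≡⟨ solve (m ∷ k ∷ o ∷ l ∷ []) ⟩
    k * l + (m * (o + l) + o * (m + k))  ≡⟨ cong (k * l +_) (cong₂ _+_ (cong (m *_) o+l≡n) (cong (o *_) m+k≡n)) ⟩
    k * l + (m * n + o * n)              ≡⟨ cong (k * l +_) (*-distribʳ-+ n m o) ⟨
    k * l + (m + o) * n                  ∎) kl<n
  where open ≡-Reasoning

module _ {w : ℕ} where

  private instance
    2^w≢0 : NonZero (2 ^ w)
    2^w≢0 = m^n≢0 2 w

  Ω? : (a b : BV w) → Dec (Ω a b)
  Ω? a b = 2 ^ w ≤? u a * u b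

  Ω₊? : (a b : BV w) → Dec (Ω₊ a b)
  Ω₊? a b = 2 ^ w ≤? u a + u b

  u<2^w : (a : BV w) → u a < 2 ^ w
  u<2^w a = toℕ<n (val a)

  u-red : ∀ n → u (red w n) ≡ n % 2 ^ w
  u-red n = toℕ-fromℕ< _

  u-red-exact : ∀ {n} → n < 2 ^ w → u (red w n) ≡ n
  u-red-exact n<2^w = trans (u-red _) (m<n⇒m%n≡m n<2^w)

  u-𝟘 : u (𝟘 {w}) ≡ 0
  u-𝟘 = u-red-exact (>-nonZero⁻¹ (2 ^ w))

  𝟘⊎0<u : (a : BV w) → a ≡ 𝟘 ⊎ 0 < u a
  𝟘⊎0<u a with u a in eq
  ... | zero  = inj₁ (cong bv (toℕ-injective (trans eq (sym u-𝟘))))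
  ... | suc _ = inj₂ z<s

  u-⊖ : (a : BV w) → 0 < u a → u (⊖ a) ≡ 2 ^ w ∸ u a
  u-⊖ a 0<a = u-red-exact (∸-monoʳ-< 0<a (<⇒≤ (u<2^w a)))

  u+u⊖≡2^w : (a : BV w) → 0 < u a → u a + u (⊖ a) ≡ 2 ^ w
  u+u⊖≡2^w a 0<a = trans (cong (u a +_) (u-⊖ a 0<a)) (m+[n∸m]≡n (<⇒≤ (u<2^w a)))

  0<u⊖ : (a : BV w) → 0 < u a → 0 < u (⊖ a)
  0<u⊖ a 0<a = subst (0 <_) (sym (u-⊖ a 0<a)) (m<n⇒0<n∸m (u<2^w a))

  ⊖-antimono-≤u : (a b : BV w) → 0 < u a → a ≤u b → ⊖ b ≤u ⊖ a
  ⊖-antimono-≤u a b 0<a a≤b =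
    subst₂ _≤_ (sym (u-⊖ b (<-≤-trans 0<a a≤b))) (sym (u-⊖ a 0<a)) (∸-monoʳ-≤ (2 ^ w) a≤b)

  ⊖-antimono-<u : (a b : BV w) → 0 < u a → a <u b → ⊖ b <u ⊖ a
  ⊖-antimono-<u a b 0<a a<b =
    subst₂ _<_ (sym (u-⊖ b (<-trans 0<a a<b))) (sym (u-⊖ a 0<a)) (∸-monoʳ-< a<b (<⇒≤ (u<2^w b)))

  ⊗-comm : (a b : BV w) → a ⊗ b ≡ b ⊗ a
  ⊗-comm a b = cong (red w) (*-comm (u a) (u b))

  ⊗-zeroʳ : (a : BV w) → a ⊗ 𝟘 ≡ 𝟘
  ⊗-zeroʳ a = cong (red w) (trans (cong (u a *_) u-𝟘) (*-zeroʳ (u a)))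

  u-⊗-≤ : (a b : BV w) → u (a ⊗ b) ≤ u a * u b
  u-⊗-≤ a b = subst (_≤ u a * u b) (sym (u-red _)) (m%n≤m (u a * u b) (2 ^ w))

  0<u⊗⇒0<uˡ : (a b : BV w) → 0 < u (a ⊗ b) → 0 < u a
  0<u⊗⇒0<uˡ a b 0<ab =
    >-nonZero⁻¹ (u a) {{m*n≢0⇒m≢0 (u a) {{>-nonZero (<-≤-trans 0<ab (u-⊗-≤ a b))}}}}

  0<u⊗⇒0<uʳ : (a b : BV w) → 0 < u (a ⊗ b) → 0 < u b
  0<u⊗⇒0<uʳ a b 0<ab =
    >-nonZero⁻¹ (u b) {{m*n≢0⇒n≢0 (u a) {{>-nonZero (<-≤-trans 0<ab (u-⊗-≤ a b))}}}}

  u-⊗-exact : (a b : BV w) → ¬ Ω a b → u (a ⊗ b) ≡ u a * u b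
  u-⊗-exact a b ¬Ω = u-red-exact (≰⇒> ¬Ω)

  u-⊗-⊖ˡ : (a b : BV w) → 0 < u a → 0 < u b → u (⊖ a) * u b < 2 ^ w →
           u (a ⊗ b) ≡ 2 ^ w ∸ u (⊖ a) * u b
  u-⊗-⊖ˡ a b 0<a 0<b bound =
    trans (u-red _) (m+k≡n⇒[m*o]%n≡n∸k*o (u a) (u (⊖ a)) (u b)
                       (u+u⊖≡2^w a 0<a) (*-mono-< (0<u⊖ a 0<a) 0<b) bound)

  u-⊗-⊖ʳ : (a b : BV w) → 0 < u a → 0 < u b → u a * u (⊖ b) < 2 ^ w →
           u (a ⊗ b) ≡ 2 ^ w ∸ u a * u (⊖ b)
  u-⊗-⊖ʳ a b 0<a 0<b bound = begin
    u (a ⊗ b)              ≡⟨ cong u (⊗-comm a b) ⟩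
    u (b ⊗ a)              ≡⟨ u-⊗-⊖ˡ b a 0<b 0<a (subst (_< 2 ^ w) (*-comm (u a) (u (⊖ b))) bound) ⟩
    2 ^ w ∸ u (⊖ b) * u a  ≡⟨ cong (2 ^ w ∸_) (*-comm (u (⊖ b)) (u a)) ⟩
    2 ^ w ∸ u a * u (⊖ b)  ∎
    where open ≡-Reasoning

  u-⊗-⊖ˡʳ : (a b : BV w) → 0 < u a → 0 < u b → u (⊖ a) * u (⊖ b) < 2 ^ w →
            u (a ⊗ b) ≡ u (⊖ a) * u (⊖ b)
  u-⊗-⊖ˡʳ a b 0<a 0<b bound =
    trans (u-red _) (m+k≡n⇒o+l≡n⇒[m*o]%n≡k*l (u a) (u (⊖ a)) (u b) (u (⊖ b))
                       (u+u⊖≡2^w a 0<a) (u+u⊖≡2^w b 0<b) bound)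

  ⊗-monoˡ-≤u : (a b x : BV w) → ¬ Ω b x → a ≤u b → a ⊗ x ≤u b ⊗ x
  ⊗-monoˡ-≤u a b x ¬Ω a≤b = begin
    u (a ⊗ x)  ≤⟨ u-⊗-≤ a x ⟩
    u a * u x  ≤⟨ *-monoˡ-≤ (u x) a≤b ⟩
    u b * u x  ≡⟨ u-⊗-exact b x ¬Ω ⟨
    u (b ⊗ x)  ∎
    where open ≤-Reasoning

  ⊗-monoˡ-<u : (a b x : BV w) → 0 < u x → ¬ Ω b x → a <u b → a ⊗ x <u b ⊗ x
  ⊗-monoˡ-<u a b x 0<x ¬Ω a<b = begin-strict
    u (a ⊗ x)  ≤⟨ u-⊗-≤ a x ⟩
    u a * u x  <⟨ *-monoˡ-< (u x) {{>-nonZero 0<x}} a<b ⟩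
    u b * u x  ≡⟨ u-⊗-exact b x ¬Ω ⟨
    u (b ⊗ x)  ∎
    where open ≤-Reasoning

  ⊗-monoʳ-≤u : (x a b : BV w) → ¬ Ω x b → a ≤u b → x ⊗ a ≤u x ⊗ b
  ⊗-monoʳ-≤u x a b ¬Ω a≤b = begin
    u (x ⊗ a)  ≤⟨ u-⊗-≤ x a ⟩
    u x * u a  ≤⟨ *-monoʳ-≤ (u x) a≤b ⟩
    u x * u b  ≡⟨ u-⊗-exact x b ¬Ω ⟨
    u (x ⊗ b)  ∎
    where open ≤-Reasoning

  ⊗-monoʳ-<u : (x a b : BV w) → 0 < u x → ¬ Ω x b → a <u b → x ⊗ a <u x ⊗ b
  ⊗-monoʳ-<u x a b 0<x ¬Ω a<b = begin-strict
    u (x ⊗ a)  ≤⟨ u-⊗-≤ x a ⟩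
    u x * u a  <⟨ *-monoʳ-< (u x) {{>-nonZero 0<x}} a<b ⟩
    u x * u b  ≡⟨ u-⊗-exact x b ¬Ω ⟨
    u (x ⊗ b)  ∎
    where open ≤-Reasoning

  ⊗-monoˡ-≤u-⊖ˡ : (a b x : BV w) → 0 < u a → 0 < u x → ¬ Ω (⊖ a) x → a ≤u b → a ⊗ x ≤u b ⊗ x
  ⊗-monoˡ-≤u-⊖ˡ a b x 0<a 0<x ¬Ω a≤b = begin
    u (a ⊗ x)              ≡⟨ u-⊗-⊖ˡ a x 0<a 0<x āx<2^w ⟩
    2 ^ w ∸ u (⊖ a) * u x  ≤⟨ ∸-monoʳ-≤ (2 ^ w) b̄x≤āx ⟩
    2 ^ w ∸ u (⊖ b) * u x  ≡⟨ u-⊗-⊖ˡ b x (<-≤-trans 0<a a≤b) 0<x (≤-<-trans b̄x≤āx āx<2^w) ⟨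
    u (b ⊗ x)              ∎
    where
      open ≤-Reasoning
      āx<2^w : u (⊖ a) * u x < 2 ^ w
      āx<2^w = ≰⇒> ¬Ω
      b̄x≤āx : u (⊖ b) * u x ≤ u (⊖ a) * u x
      b̄x≤āx = *-monoˡ-≤ (u x) (⊖-antimono-≤u a b 0<a a≤b)

  ⊗-monoˡ-<u-⊖ˡ : (a b x : BV w) → 0 < u a → 0 < u x → ¬ Ω (⊖ a) x → a <u b → a ⊗ x <u b ⊗ x
  ⊗-monoˡ-<u-⊖ˡ a b x 0<a 0<x ¬Ω a<b = begin-strict
    u (a ⊗ x)              ≡⟨ u-⊗-⊖ˡ a x 0<a 0<x āx<2^w ⟩
    2 ^ w ∸ u (⊖ a) * u x  <⟨ ∸-monoʳ-< b̄x<āx (<⇒≤ āx<2^w) ⟩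
    2 ^ w ∸ u (⊖ b) * u x  ≡⟨ u-⊗-⊖ˡ b x (<-trans 0<a a<b) 0<x (<-trans b̄x<āx āx<2^w) ⟨
    u (b ⊗ x)              ∎
    where
      open ≤-Reasoning
      āx<2^w : u (⊖ a) * u x < 2 ^ w
      āx<2^w = ≰⇒> ¬Ω
      b̄x<āx : u (⊖ b) * u x < u (⊖ a) * u x
      b̄x<āx = *-monoˡ-< (u x) {{>-nonZero 0<x}} (⊖-antimono-<u a b 0<a a<b)

  ⊗-antimonoˡ-≤u-⊖ʳ : (a b x : BV w) → 0 < u a → 0 < u x → ¬ Ω b (⊖ x) → a ≤u b → b ⊗ x ≤u a ⊗ x
  ⊗-antimonoˡ-≤u-⊖ʳ a b x 0<a 0<x ¬Ω a≤b = begin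
    u (b ⊗ x)              ≡⟨ u-⊗-⊖ʳ b x (<-≤-trans 0<a a≤b) 0<x bx̄<2^w ⟩
    2 ^ w ∸ u b * u (⊖ x)  ≤⟨ ∸-monoʳ-≤ (2 ^ w) ax̄≤bx̄ ⟩
    2 ^ w ∸ u a * u (⊖ x)  ≡⟨ u-⊗-⊖ʳ a x 0<a 0<x (≤-<-trans ax̄≤bx̄ bx̄<2^w) ⟨
    u (a ⊗ x)              ∎
    where
      open ≤-Reasoning
      bx̄<2^w : u b * u (⊖ x) < 2 ^ w
      bx̄<2^w = ≰⇒> ¬Ω
      ax̄≤bx̄ : u a * u (⊖ x) ≤ u b * u (⊖ x)
      ax̄≤bx̄ = *-monoˡ-≤ (u (⊖ x)) a≤b

  ⊗-antimonoˡ-<u-⊖ʳ : (a b x : BV w) → 0 < u a → 0 < u x → ¬ Ω b (⊖ x) → a <u b → b ⊗ x <u a ⊗ x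
  ⊗-antimonoˡ-<u-⊖ʳ a b x 0<a 0<x ¬Ω a<b = begin-strict
    u (b ⊗ x)              ≡⟨ u-⊗-⊖ʳ b x (<-trans 0<a a<b) 0<x bx̄<2^w ⟩
    2 ^ w ∸ u b * u (⊖ x)  <⟨ ∸-monoʳ-< ax̄<bx̄ (<⇒≤ bx̄<2^w) ⟩
    2 ^ w ∸ u a * u (⊖ x)  ≡⟨ u-⊗-⊖ʳ a x 0<a 0<x (<-trans ax̄<bx̄ bx̄<2^w) ⟨
    u (a ⊗ x)              ∎
    where
      open ≤-Reasoning
      bx̄<2^w : u b * u (⊖ x) < 2 ^ w
      bx̄<2^w = ≰⇒> ¬Ω
      ax̄<bx̄ : u a * u (⊖ x) < u b * u (⊖ x)
      ax̄<bx̄ = *-monoˡ-< (u (⊖ x)) {{>-nonZero (0<u⊖ x 0<x)}} a<b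

  ⊗-antimonoˡ-≤u-⊖ˡʳ : (a b x : BV w) → 0 < u a → 0 < u x → ¬ Ω (⊖ a) (⊖ x) → a ≤u b → b ⊗ x ≤u a ⊗ x
  ⊗-antimonoˡ-≤u-⊖ˡʳ a b x 0<a 0<x ¬Ω a≤b = begin
    u (b ⊗ x)          ≡⟨ u-⊗-⊖ˡʳ b x (<-≤-trans 0<a a≤b) 0<x (≤-<-trans b̄x̄≤āx̄ āx̄<2^w) ⟩
    u (⊖ b) * u (⊖ x)  ≤⟨ b̄x̄≤āx̄ ⟩
    u (⊖ a) * u (⊖ x)  ≡⟨ u-⊗-⊖ˡʳ a x 0<a 0<x āx̄<2^w ⟨
    u (a ⊗ x)          ∎
    where
      open ≤-Reasoning
      āx̄<2^w : u (⊖ a) * u (⊖ x) < 2 ^ w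
      āx̄<2^w = ≰⇒> ¬Ω
      b̄x̄≤āx̄ : u (⊖ b) * u (⊖ x) ≤ u (⊖ a) * u (⊖ x)
      b̄x̄≤āx̄ = *-monoˡ-≤ (u (⊖ x)) (⊖-antimono-≤u a b 0<a a≤b)

  ⊗-antimonoˡ-<u-⊖ˡʳ : (a b x : BV w) → 0 < u a → 0 < u x → ¬ Ω (⊖ a) (⊖ x) → a <u b → b ⊗ x <u a ⊗ x
  ⊗-antimonoˡ-<u-⊖ˡʳ a b x 0<a 0<x ¬Ω a<b = begin-strict
    u (b ⊗ x)          ≡⟨ u-⊗-⊖ˡʳ b x (<-trans 0<a a<b) 0<x (<-trans b̄x̄<āx̄ āx̄<2^w) ⟩
    u (⊖ b) * u (⊖ x)  <⟨ b̄x̄<āx̄ ⟩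
    u (⊖ a) * u (⊖ x)  ≡⟨ u-⊗-⊖ˡʳ a x 0<a 0<x āx̄<2^w ⟨
    u (a ⊗ x)          ∎
    where
      open ≤-Reasoning
      āx̄<2^w : u (⊖ a) * u (⊖ x) < 2 ^ w
      āx̄<2^w = ≰⇒> ¬Ω
      b̄x̄<āx̄ : u (⊖ b) * u (⊖ x) < u (⊖ a) * u (⊖ x)
      b̄x̄<āx̄ = *-monoˡ-< (u (⊖ x)) {{>-nonZero (0<u⊖ x 0<x)}} (⊖-antimono-<u a b 0<a a<b)

  ⊗ʳ-<u⇒≢ : (p q x : BV w) → p ⊗ x <u q ⊗ x → p ≢ q
  ⊗ʳ-<u⇒≢ p q x px<qx refl = <-irrefl refl px<qx

  ⊗-cancelʳ-<u : (p q x : BV w) → p ⊗ x <u q ⊗ x → Ω p x ⊎ p <u q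
  ⊗-cancelʳ-<u p q x px<qx with Ω? p x | u p <? u q
  ... | yes ω | _       = inj₁ ω
  ... | _     | yes p<q = inj₂ p<q
  ... | no ¬ω | no p≮q  = contradiction (⊗-monoˡ-≤u q p x ¬ω (≮⇒≥ p≮q)) (<⇒≱ px<qx)

  ⊗-cancelʳ-<u-⊖ˡ : (p q x : BV w) → p ⊗ x <u q ⊗ x → Ω (⊖ q) x ⊎ p <u q
  ⊗-cancelʳ-<u-⊖ˡ p q x px<qx with Ω? (⊖ q) x | u p <? u q
  ... | yes ω | _       = inj₁ ω
  ... | _     | yes p<q = inj₂ p<q
  ... | no ¬ω | no p≮q  = contradiction (⊗-monoˡ-≤u-⊖ˡ q p x 0<q 0<x ¬ω (≮⇒≥ p≮q)) (<⇒≱ px<qx)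
    where
      0<q : 0 < u q
      0<q = 0<u⊗⇒0<uˡ q x (m<n⇒0<n px<qx)
      0<x : 0 < u x
      0<x = 0<u⊗⇒0<uʳ q x (m<n⇒0<n px<qx)

  ⊗-cancelʳ-<u-⊖ʳ : (p q x : BV w) → p ⊗ x <u q ⊗ x → Ω q (⊖ x) ⊎ p >u q ⊎ p ≡ 𝟘
  ⊗-cancelʳ-<u-⊖ʳ p q x px<qx with 𝟘⊎0<u p | Ω? q (⊖ x) | u q <? u p
  ... | inj₁ p≡𝟘 | _     | _       = inj₂ (inj₂ p≡𝟘)
  ... | _        | yes ω | _       = inj₁ ω
  ... | _        | _     | yes q<p = inj₂ (inj₁ q<p)
  ... | inj₂ 0<p | no ¬ω | no q≮p  =
    contradiction (⊗-antimonoˡ-≤u-⊖ʳ p q x 0<p 0<x ¬ω (≮⇒≥ q≮p)) (<⇒≱ px<qx)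
    where
      0<x : 0 < u x
      0<x = 0<u⊗⇒0<uʳ q x (m<n⇒0<n px<qx)

  ⊗-cancelʳ-<u-⊖ˡʳ : (p q x : BV w) → p ⊗ x <u q ⊗ x → Ω (⊖ p) (⊖ x) ⊎ p >u q ⊎ p ≡ 𝟘
  ⊗-cancelʳ-<u-⊖ˡʳ p q x px<qx with 𝟘⊎0<u p | Ω? (⊖ p) (⊖ x) | u q <? u p
  ... | inj₁ p≡𝟘 | _     | _       = inj₂ (inj₂ p≡𝟘)
  ... | _        | yes ω | _       = inj₁ ω
  ... | _        | _     | yes q<p = inj₂ (inj₁ q<p)
  ... | inj₂ 0<p | no ¬ω | no q≮p  =
    contradiction (⊗-antimonoˡ-≤u-⊖ˡʳ p q x 0<p 0<x ¬ω (≮⇒≥ q≮p)) (<⇒≱ px<qx)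
    where
      0<x : 0 < u x
      0<x = 0<u⊗⇒0<uʳ q x (m<n⇒0<n px<qx)

  ⊗-cancelʳ-≤u : (p q x : BV w) → p ⊗ x ≤u q ⊗ x → Ω p x ⊎ p ≤u q ⊎ x ≡ 𝟘
  ⊗-cancelʳ-≤u p q x px≤qx with 𝟘⊎0<u x | Ω? p x | u p ≤? u q
  ... | inj₁ x≡𝟘 | _     | _       = inj₂ (inj₂ x≡𝟘)
  ... | _        | yes ω | _       = inj₁ ω
  ... | _        | _     | yes p≤q = inj₂ (inj₁ p≤q)
  ... | inj₂ 0<x | no ¬ω | no p≰q  =
    contradiction (⊗-monoˡ-<u q p x 0<x ¬ω (≰⇒> p≰q)) (≤⇒≯ px≤qx)

  ⊗-cancelʳ-≤u-⊖ˡ : (p q x : BV w) → p ⊗ x ≤u q ⊗ x → Ω (⊖ q) x ⊎ p ≤u q ⊎ x ≡ 𝟘 ⊎ q ≡ 𝟘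
  ⊗-cancelʳ-≤u-⊖ˡ p q x px≤qx with 𝟘⊎0<u x | 𝟘⊎0<u q | Ω? (⊖ q) x | u p ≤? u q
  ... | inj₁ x≡𝟘 | _        | _     | _       = inj₂ (inj₂ (inj₁ x≡𝟘))
  ... | _        | inj₁ q≡𝟘 | _     | _       = inj₂ (inj₂ (inj₂ q≡𝟘))
  ... | _        | _        | yes ω | _       = inj₁ ω
  ... | _        | _        | _     | yes p≤q = inj₂ (inj₁ p≤q)
  ... | inj₂ 0<x | inj₂ 0<q | no ¬ω | no p≰q  =
    contradiction (⊗-monoˡ-<u-⊖ˡ q p x 0<q 0<x ¬ω (≰⇒> p≰q)) (≤⇒≯ px≤qx)

  ⊗-cancelʳ-≤u-⊖ʳ : (p q x : BV w) → p ⊗ x ≤u q ⊗ x → Ω q (⊖ x) ⊎ p ≥u q ⊎ x ≡ 𝟘 ⊎ p ≡ 𝟘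
  ⊗-cancelʳ-≤u-⊖ʳ p q x px≤qx with 𝟘⊎0<u x | 𝟘⊎0<u p | Ω? q (⊖ x) | u q ≤? u p
  ... | inj₁ x≡𝟘 | _        | _     | _       = inj₂ (inj₂ (inj₁ x≡𝟘))
  ... | _        | inj₁ p≡𝟘 | _     | _       = inj₂ (inj₂ (inj₂ p≡𝟘))
  ... | _        | _        | yes ω | _       = inj₁ ω
  ... | _        | _        | _     | yes q≤p = inj₂ (inj₁ q≤p)
  ... | inj₂ 0<x | inj₂ 0<p | no ¬ω | no q≰p  =
    contradiction (⊗-antimonoˡ-<u-⊖ʳ p q x 0<p 0<x ¬ω (≰⇒> q≰p)) (≤⇒≯ px≤qx)

  ⊗-cancelʳ-≤u-⊖ˡʳ : (p q x : BV w) → p ⊗ x ≤u q ⊗ x → Ω (⊖ p) (⊖ x) ⊎ p ≥u q ⊎ x ≡ 𝟘 ⊎ p ≡ 𝟘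
  ⊗-cancelʳ-≤u-⊖ˡʳ p q x px≤qx with 𝟘⊎0<u x | 𝟘⊎0<u p | Ω? (⊖ p) (⊖ x) | u q ≤? u p
  ... | inj₁ x≡𝟘 | _        | _     | _       = inj₂ (inj₂ (inj₁ x≡𝟘))
  ... | _        | inj₁ p≡𝟘 | _     | _       = inj₂ (inj₂ (inj₂ p≡𝟘))
  ... | _        | _        | yes ω | _       = inj₁ ω
  ... | _        | _        | _     | yes q≤p = inj₂ (inj₁ q≤p)
  ... | inj₂ 0<x | inj₂ 0<p | no ¬ω | no q≰p  =
    contradiction (⊗-antimonoˡ-<u-⊖ˡʳ p q x 0<p 0<x ¬ω (≰⇒> q≰p)) (≤⇒≯ px≤qx)

  ⊗-⊕-≤-trans : (p q r s x : BV w) → p ⊗ x ⊕ s ≤u q → Ω p x ⊎ Ω₊ (p ⊗ x) s ⊎ p ⊗ r ≤u q ⊎ x <u r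
  ⊗-⊕-≤-trans p q r s x px+s≤q with Ω? p x | Ω₊? (p ⊗ x) s | u x <? u r
  ... | yes ω | _      | _       = inj₁ ω
  ... | _     | yes ω₊ | _       = inj₂ (inj₁ ω₊)
  ... | _     | _      | yes x<r = inj₂ (inj₂ (inj₂ x<r))
  ... | no ¬ω | no ¬ω₊ | no x≮r  = inj₂ (inj₂ (inj₁ (begin
    u (p ⊗ r)        ≤⟨ ⊗-monoʳ-≤u p r x ¬ω (≮⇒≥ x≮r) ⟩
    u (p ⊗ x)        ≤⟨ m≤m+n (u (p ⊗ x)) (u s) ⟩
    u (p ⊗ x) + u s  ≡⟨ u-red-exact (≰⇒> ¬ω₊) ⟨
    u (p ⊗ x ⊕ s)    ≤⟨ px+s≤q ⟩
    u q              ∎)))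
    where open ≤-Reasoning

  ⊗-≤-≤-trans : (p q r x : BV w) → p ≤u x × q ⊗ x ≤u r → Ω q x ⊎ p ⊗ q ≤u r
  ⊗-≤-≤-trans p q r x (p≤x , qx≤r) with Ω? q x
  ... | yes ω = inj₁ ω
  ... | no ¬ω = inj₂ (subst (_≤u r) (⊗-comm q p) (≤-trans (⊗-monoʳ-≤u q p x ¬ω p≤x) qx≤r))

  ⊗-≤-<-trans : (p q r x : BV w) → p ≤u x × q ⊗ x <u r → Ω q x ⊎ p ⊗ q <u r
  ⊗-≤-<-trans p q r x (p≤x , qx<r) with Ω? q x
  ... | yes ω = inj₁ ω
  ... | no ¬ω = inj₂ (subst (_<u r) (⊗-comm q p) (≤-<-trans (⊗-monoʳ-≤u q p x ¬ω p≤x) qx<r))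

  ⊗-<-≤-trans : (p q r x : BV w) → p <u x × q ⊗ x ≤u r → Ω q x ⊎ p ⊗ q <u r ⊎ q ≡ 𝟘
  ⊗-<-≤-trans p q r x (p<x , qx≤r) with 𝟘⊎0<u q | Ω? q x
  ... | inj₁ q≡𝟘 | _     = inj₂ (inj₂ q≡𝟘)
  ... | _        | yes ω = inj₁ ω
  ... | inj₂ 0<q | no ¬ω =
    inj₂ (inj₁ (subst (_<u r) (⊗-comm q p) (<-≤-trans (⊗-monoʳ-<u q p x 0<q ¬ω p<x) qx≤r)))

  ⊗-<-≤-trans′ : (p q r x : BV w) → p <u x × q ⊗ x ≤u r → Ω q x ⊎ p ⊗ q <u r ⊎ r ≡ 𝟘
  ⊗-<-≤-trans′ p q r x h with ⊗-<-≤-trans p q r x h | 𝟘⊎0<u r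
  ... | inj₁ ω           | _        = inj₁ ω
  ... | inj₂ (inj₁ pq<r) | _        = inj₂ (inj₁ pq<r)
  ... | _                | inj₁ r≡𝟘 = inj₂ (inj₂ r≡𝟘)
  ... | inj₂ (inj₂ refl) | inj₂ 0<r =
    inj₂ (inj₁ (subst (_< u r) (sym (trans (cong u (⊗-zeroʳ p)) u-𝟘)) 0<r))

  ≤-⊗-≤-trans : (p q r x : BV w) → p ≤u q ⊗ x × x ≤u r → Ω q r ⊎ p ≤u q ⊗ r
  ≤-⊗-≤-trans p q r x (p≤qx , x≤r) with Ω? q r
  ... | yes ω = inj₁ ω
  ... | no ¬ω = inj₂ (≤-trans p≤qx (⊗-monoʳ-≤u q x r ¬ω x≤r))

  <-⊗-≤-trans : (p q r x : BV w) → p <u q ⊗ x × x ≤u r → Ω q r ⊎ p <u q ⊗ r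
  <-⊗-≤-trans p q r x (p<qx , x≤r) with Ω? q r
  ... | yes ω = inj₁ ω
  ... | no ¬ω = inj₂ (<-≤-trans p<qx (⊗-monoʳ-≤u q x r ¬ω x≤r))

  ≤-⊗-<-trans : (p q r x : BV w) → p ≤u q ⊗ x × x <u r → Ω q r ⊎ p <u q ⊗ r ⊎ p ≡ 𝟘
  ≤-⊗-<-trans p q r x (p≤qx , x<r) with 𝟘⊎0<u p | Ω? q r
  ... | inj₁ p≡𝟘 | _     = inj₂ (inj₂ p≡𝟘)
  ... | _        | yes ω = inj₁ ω
  ... | inj₂ 0<p | no ¬ω = inj₂ (inj₁ (≤-<-trans p≤qx (⊗-monoʳ-<u q x r 0<q ¬ω x<r)))
    where
      0<q : 0 < u q
      0<q = 0<u⊗⇒0<uˡ q x (<-≤-trans 0<p p≤qx)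

  ≤-⊗-<-trans′ : (p q r x : BV w) → p ≤u q ⊗ x × x <u r → Ω q r ⊎ p <u q ⊗ r ⊎ q ≡ 𝟘
  ≤-⊗-<-trans′ p q r x (p≤qx , x<r) with 𝟘⊎0<u q | Ω? q r
  ... | inj₁ q≡𝟘 | _     = inj₂ (inj₂ q≡𝟘)
  ... | _        | yes ω = inj₁ ω
  ... | inj₂ 0<q | no ¬ω = inj₂ (inj₁ (≤-<-trans p≤qx (⊗-monoʳ-<u q x r 0<q ¬ω x<r)))

lemma9 : (w : ℕ) → 1 ≤ w → (p q r s x : BV w) →
    ((p ⊗ x <u q ⊗ x → p ≢ q)
    × (p ⊗ x <u q ⊗ x → Ω p x ⊎ p <u q)
    × (p ⊗ x <u q ⊗ x → Ω (⊖ q) x ⊎ p <u q)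
    × (p ⊗ x <u q ⊗ x → Ω q (⊖ x) ⊎ p >u q ⊎ p ≡ 𝟘)
    × (p ⊗ x <u q ⊗ x → Ω (⊖ p) (⊖ x) ⊎ p >u q ⊎ p ≡ 𝟘)
    × (p ⊗ x ≤u q ⊗ x → Ω p x ⊎ p ≤u q ⊎ x ≡ 𝟘)
    × (p ⊗ x ≤u q ⊗ x → Ω (⊖ q) x ⊎ p ≤u q ⊎ x ≡ 𝟘 ⊎ q ≡ 𝟘)
    × (p ⊗ x ≤u q ⊗ x → Ω q (⊖ x) ⊎ p ≥u q ⊎ x ≡ 𝟘 ⊎ p ≡ 𝟘)
    × (p ⊗ x ≤u q ⊗ x → Ω (⊖ p) (⊖ x) ⊎ p ≥u q ⊎ x ≡ 𝟘 ⊎ p ≡ 𝟘)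
    × (p ⊗ x ⊕ s ≤u q → Ω p x ⊎ Ω₊ (p ⊗ x) s ⊎ p ⊗ r ≤u q ⊎ x <u r)
    × (p ≤u x × q ⊗ x ≤u r → Ω q x ⊎ p ⊗ q ≤u r)
    × (p ≤u x × q ⊗ x <u r → Ω q x ⊎ p ⊗ q <u r)
    × (p <u x × q ⊗ x ≤u r → Ω q x ⊎ p ⊗ q <u r ⊎ q ≡ 𝟘)
    × (p <u x × q ⊗ x ≤u r → Ω q x ⊎ p ⊗ q <u r ⊎ r ≡ 𝟘)
    × (p ≤u q ⊗ x × x ≤u r → Ω q r ⊎ p ≤u q ⊗ r)
    × (p <u q ⊗ x × x ≤u r → Ω q r ⊎ p <u q ⊗ r)
    × (p ≤u q ⊗ x × x <u r → Ω q r ⊎ p <u q ⊗ r ⊎ p ≡ 𝟘)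
    × (p ≤u q ⊗ x × x <u r → Ω q r ⊎ p <u q ⊗ r ⊎ q ≡ 𝟘))
lemma9 _ _ p q r s x =
    ⊗ʳ-<u⇒≢ p q x
  , ⊗-cancelʳ-<u p q x , ⊗-cancelʳ-<u-⊖ˡ p q x , ⊗-cancelʳ-<u-⊖ʳ p q x , ⊗-cancelʳ-<u-⊖ˡʳ p q x
  , ⊗-cancelʳ-≤u p q x , ⊗-cancelʳ-≤u-⊖ˡ p q x , ⊗-cancelʳ-≤u-⊖ʳ p q x , ⊗-cancelʳ-≤u-⊖ˡʳ p q x
  , ⊗-⊕-≤-trans p q r s x
  , ⊗-≤-≤-trans p q r x , ⊗-≤-<-trans p q r x , ⊗-<-≤-trans p q r x , ⊗-<-≤-trans′ p q r x
  , ≤-⊗-≤-trans p q r x , <-⊗-≤-trans p q r x , ≤-⊗-<-trans p q r x , ≤-⊗-<-trans′ p q r x
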